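{- Every negative translation $N$ into $\mathsf{IL}$ is idempotent in $\mathsf{IL}$: for all formulas $A$, $\mathsf{IL} \vdash N(N(A)) \leftrightarrow N(A)$. Likewise, every negative translation $N$ into $\mathsf{ML}$ satisfies $\mathsf{ML} \vdash N(N(A)) \leftrightarrow N(A)$ for all formulas $A$.
   Context: $\mathsf{CL}$ is pure first-order classical predicate logic based on $\bot, \wedge, \vee, \to, \forall, \exists$ (with $\neg A :\equiv A\to\bot$, $A\leftrightarrow B :\equiv (A\to B)\wedge(B\to A)$); $\mathsf{IL}$ and $\mathsf{ML}$ are its intuitionistic and minimal counterparts. A function $N$ from formulas to formulas is a negative translation into $\mathsf{IL}$ (resp. $\mathsf{ML}$) if (soundness) for all formulas $A$ and all sets $\Gamma$ of possibly open formulas, $\mathsf{CL}+\Gamma\vdash A$ implies $\mathsf{IL}+N(\Gamma)\vdash N(A)$ (resp. $\mathsf{ML}+N(\Gamma)\vdash N(A)$), where $N(\Gamma)=\{N(B):B\in\Gamma\}$; and (characterisation) $\mathsf{CL}\vdash N(A)\leftrightarrow A$ for all formulas $A$. -}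

module Defs where

open import Data.Nat using (ℕ; zero; suc)
open import Data.Vec using (Vec)
import Data.Vec as Vec
open import Data.Product using (Σ; _×_; _,_)
open import Data.Sum using (_⊎_)
open import Data.Empty using (⊥)
open import Relation.Binary.PropositionalEquality using (_≡_)

data Logic : Set where
  CL IL ML : Logic

data HasEFQ : Logic → Set where
  efq-CL : HasEFQ CL
  efq-IL : HasEFQ IL

-- Terms are variables only
-- (no function symbols), represented as de Bruijn indices.
module FOL (Pred : ℕ → Set) where

  Term : Set
  Term = ℕ

  infixr 6 _∧'_
  infixr 5 _∨'_
  infixr 4 _⇒_

  data Fm : Set where
    atom : ∀ {n} → Pred n → Vec Term n → Fm
    ⊥'   : Fm
    _∧'_ : Fm → Fm → Fm
    _∨'_ : Fm → Fm → Fm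
    _⇒_  : Fm → Fm → Fm
    all  : Fm → Fm          -- ∀ binds de Bruijn index 0
    ex   : Fm → Fm          -- ∃ binds de Bruijn index 0

  ¬' : Fm → Fm
  ¬' A = A ⇒ ⊥'

  _⇔_ : Fm → Fm → Fm
  A ⇔ B = (A ⇒ B) ∧' (B ⇒ A)

  ext : (ℕ → ℕ) → ℕ → ℕ
  ext ρ zero    = zero
  ext ρ (suc n) = suc (ρ n)

  ren : (ℕ → ℕ) → Fm → Fm
  ren ρ (atom P ts) = atom P (Vec.map ρ ts)
  ren ρ ⊥'          = ⊥'
  ren ρ (A ∧' B)    = ren ρ A ∧' ren ρ B
  ren ρ (A ∨' B)    = ren ρ A ∨' ren ρ B
  ren ρ (A ⇒ B)     = ren ρ A ⇒ ren ρ B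
  ren ρ (all A)     = all (ren (ext ρ) A)
  ren ρ (ex A)      = ex (ren (ext ρ) A)

  sub0 : Term → ℕ → ℕ
  sub0 t zero    = t
  sub0 t (suc n) = n

  inst : Fm → Term → Fm
  inst A t = ren (sub0 t) A

  FmSet : Set₁
  FmSet = Fm → Set

  _,,_ : FmSet → Fm → FmSet
  (Γ ,, A) B = Γ B ⊎ B ≡ A

  -- shift all free variables of a set (used for eigenvariable conditions)
  ↑ : FmSet → FmSet
  ↑ Γ B = Σ Fm λ C → Γ C × B ≡ ren suc C

  image : (Fm → Fm) → FmSet → FmSet
  image N Γ B = Σ Fm λ C → Γ C × B ≡ N C

  infix 2 _∶_⊢_
  data _∶_⊢_ (L : Logic) (Γ : FmSet) : Fm → Set₁ where
    ass  : ∀ {A} → Γ A → L ∶ Γ ⊢ A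
    ∧I   : ∀ {A B} → L ∶ Γ ⊢ A → L ∶ Γ ⊢ B → L ∶ Γ ⊢ A ∧' B
    ∧E₁  : ∀ {A B} → L ∶ Γ ⊢ A ∧' B → L ∶ Γ ⊢ A
    ∧E₂  : ∀ {A B} → L ∶ Γ ⊢ A ∧' B → L ∶ Γ ⊢ B
    ∨I₁  : ∀ {A B} → L ∶ Γ ⊢ A → L ∶ Γ ⊢ A ∨' B
    ∨I₂  : ∀ {A B} → L ∶ Γ ⊢ B → L ∶ Γ ⊢ A ∨' B
    ∨E   : ∀ {A B C} → L ∶ Γ ⊢ A ∨' B → L ∶ (Γ ,, A) ⊢ C → L ∶ (Γ ,, B) ⊢ C
           → L ∶ Γ ⊢ C
    ⇒I   : ∀ {A B} → L ∶ (Γ ,, A) ⊢ B → L ∶ Γ ⊢ A ⇒ B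
    ⇒E   : ∀ {A B} → L ∶ Γ ⊢ A ⇒ B → L ∶ Γ ⊢ A → L ∶ Γ ⊢ B
    ∀I   : ∀ {A} → L ∶ ↑ Γ ⊢ A → L ∶ Γ ⊢ all A
    ∀E   : ∀ {A} (t : Term) → L ∶ Γ ⊢ all A → L ∶ Γ ⊢ inst A t
    ∃I   : ∀ {A} (t : Term) → L ∶ Γ ⊢ inst A t → L ∶ Γ ⊢ ex A
    ∃E   : ∀ {A C} → L ∶ Γ ⊢ ex A → L ∶ (↑ Γ ,, A) ⊢ ren suc C → L ∶ Γ ⊢ C
    efq  : ∀ {A} → HasEFQ L → L ∶ Γ ⊢ ⊥' → L ∶ Γ ⊢ A
    raa  : ∀ {A} → L ≡ CL → L ∶ (Γ ,, ¬' A) ⊢ ⊥' → L ∶ Γ ⊢ A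

  ∅ : FmSet
  ∅ _ = ⊥

  record IsNegTranslation (L : Logic) (N : Fm → Fm) : Set₁ where
    field
      soundness : (Γ : FmSet) (A : Fm) → CL ∶ Γ ⊢ A → L ∶ image N Γ ⊢ N A
      characterisation : (A : Fm) → CL ∶ ∅ ⊢ (N A ⇔ A)

-- Soundness applied to the one-assumption derivations {N A} ⊢ A and {A} ⊢ N A,
-- which exist classically by characterisation, yields N (N A) → N A and
-- N A → N (N A) in the target logic.
module Submission where

open import Defs
open import Data.Nat using (ℕ)
open import Data.Product using (_×_; _,_)
open import Data.Sum using (inj₁; inj₂)
open import Relation.Binary.PropositionalEquality using (refl)

module _ (Pred : ℕ → Set) where
  open FOL Pred

  -- A record rather than a function type, so that Γ and Δ are inferable.
  infix 4 _⊆_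
  record _⊆_ (Γ Δ : FmSet) : Set where
    constructor ⊆-intro
    field ⊆-apply : ∀ {B} → Γ B → Δ B
  open _⊆_

  ,,⁺ : ∀ {Γ Δ} A → Γ ⊆ Δ → Γ ,, A ⊆ Δ ,, A
  ,,⁺ A Γ⊆Δ = ⊆-intro λ { (inj₁ x) → inj₁ (⊆-apply Γ⊆Δ x) ; (inj₂ e) → inj₂ e }

  ↑⁺ : ∀ {Γ Δ} → Γ ⊆ Δ → ↑ Γ ⊆ ↑ Δ
  ↑⁺ Γ⊆Δ = ⊆-intro λ { (C , x , e) → C , ⊆-apply Γ⊆Δ x , e }

  weaken : ∀ {L Γ Δ A} → Γ ⊆ Δ → L ∶ Γ ⊢ A → L ∶ Δ ⊢ A
  weaken Γ⊆Δ (ass x)               = ass (⊆-apply Γ⊆Δ x)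
  weaken Γ⊆Δ (∧I p q)              = ∧I (weaken Γ⊆Δ p) (weaken Γ⊆Δ q)
  weaken Γ⊆Δ (∧E₁ p)               = ∧E₁ (weaken Γ⊆Δ p)
  weaken Γ⊆Δ (∧E₂ p)               = ∧E₂ (weaken Γ⊆Δ p)
  weaken Γ⊆Δ (∨I₁ p)               = ∨I₁ (weaken Γ⊆Δ p)
  weaken Γ⊆Δ (∨I₂ p)               = ∨I₂ (weaken Γ⊆Δ p)
  weaken Γ⊆Δ (∨E {A = A} {B} p q r) =
    ∨E (weaken Γ⊆Δ p) (weaken (,,⁺ A Γ⊆Δ) q) (weaken (,,⁺ B Γ⊆Δ) r)
  weaken Γ⊆Δ (⇒I {A = A} p)        = ⇒I (weaken (,,⁺ A Γ⊆Δ) p)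
  weaken Γ⊆Δ (⇒E p q)              = ⇒E (weaken Γ⊆Δ p) (weaken Γ⊆Δ q)
  weaken Γ⊆Δ (∀I p)                = ∀I (weaken (↑⁺ Γ⊆Δ) p)
  weaken Γ⊆Δ (∀E t p)              = ∀E t (weaken Γ⊆Δ p)
  weaken Γ⊆Δ (∃I t p)              = ∃I t (weaken Γ⊆Δ p)
  weaken Γ⊆Δ (∃E {A = A} p q)      = ∃E (weaken Γ⊆Δ p) (weaken (,,⁺ A (↑⁺ Γ⊆Δ)) q)
  weaken Γ⊆Δ (efq h p)             = efq h (weaken Γ⊆Δ p)
  weaken Γ⊆Δ (raa {A = A} e p)     = raa e (weaken (,,⁺ (¬' A) Γ⊆Δ) p)

  ⇒-unI : ∀ {L Γ A B} → L ∶ Γ ⊢ A ⇒ B → L ∶ Γ ,, A ⊢ B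
  ⇒-unI p = ⇒E (weaken (⊆-intro inj₁) p) (ass (inj₂ refl))

  image-singleton : ∀ N A → image N (∅ ,, A) ⊆ ∅ ,, N A
  image-singleton N A = ⊆-intro λ { (_ , inj₂ refl , refl) → inj₂ refl }

  module _ {L N} (isN : IsNegTranslation L N) where
    open IsNegTranslation isN

    translate-⇒ : ∀ {A B} → CL ∶ ∅ ,, A ⊢ B → L ∶ ∅ ⊢ N A ⇒ N B
    translate-⇒ {A} {B} p =
      ⇒I (weaken (image-singleton N A) (soundness (∅ ,, A) B p))

    translate-⇔ : ∀ {A B} → CL ∶ ∅ ⊢ A ⇔ B → L ∶ ∅ ⊢ N A ⇔ N B
    translate-⇔ p = ∧I (translate-⇒ (⇒-unI (∧E₁ p))) (translate-⇒ (⇒-unI (∧E₂ p)))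

    idempotent : ∀ A → L ∶ ∅ ⊢ N (N A) ⇔ N A
    idempotent A = translate-⇔ (characterisation A)

proposition4 : (Pred : ℕ → Set) → let open FOL Pred in
    ((N : Fm → Fm) → IsNegTranslation IL N → (A : Fm) → IL ∶ ∅ ⊢ (N (N A) ⇔ N A))
    × ((N : Fm → Fm) → IsNegTranslation ML N → (A : Fm) → ML ∶ ∅ ⊢ (N (N A) ⇔ N A))
proposition4 Pred = (λ _ → idempotent Pred) , (λ _ → idempotent Pred)
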